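{- Let $\mathscr{P}_{T_{\mathrm{I}}}$ be the set of partitions $\lambda_1\ge\lambda_2\ge\cdots\ge\lambda_\ell\ge1$ (empty partition included) with $\lambda_i-\lambda_{i+2}\ge 3$ for all applicable $i$, and such that $\lambda_i-\lambda_{i+1}\le 1$ implies $\lambda_i+\lambda_{i+1}\equiv 0\pmod 3$. Let $G(x)=G(x,q)=\sum_{\lambda}x^{\sharp(\lambda)}q^{|\lambda|}$ over those $\lambda\in\mathscr{P}_{T_{\mathrm{I}}}$ whose smallest part is at least $2$ (empty partition included), where $\sharp(\lambda)$ is the number of parts and $|\lambda|$ the sum of parts. Then $$p_0(x,q)G(x)+p_3(x,q)G(xq^3)+p_6(x,q)G(xq^6)+p_9(x,q)G(xq^9)=0,$$ where \begin{align*} p_0&=1+x(q^5+q^8),\\ p_3&=-1-x(q^2+q^3+q^4+q^5+q^8)-x^2(2q^6+q^7+q^8+q^9+q^{10}+q^{11}+q^{12})-x^3(q^{11}+2q^{14}+q^{17}),\\ p_6&=x^3(q^{16}+q^{17})+x^4(-q^{17}+q^{18}+q^{19}+q^{21}+q^{22}+q^{23}+q^{24})+x^5(q^{26}+q^{29}),\\ p_9&=x^5q^{33}+x^6(q^{35}+q^{38}). \end{align*} -}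

module Defs where

open import Data.Nat using (ℕ; zero; suc; _+_; _*_; _∸_; _≤ᵇ_; _≡ᵇ_; _%_)
open import Data.Bool using (Bool; true; false; _∧_; if_then_else_)
open import Data.List using (List; []; _∷_; length; filter; map; concatMap; upTo)
open import Data.Nat.ListAction using (sum)
open import Data.Product using (_×_; _,_)
open import Data.Integer as ℤ using (ℤ; +_; -_)
open import Relation.Binary.PropositionalEquality using (_≡_)
open import Relation.Nullary.Decidable using (Dec; yes; no)
open import Data.Bool using (_≟_)

-- Partitions are written as lists  λ₁ ∷ λ₂ ∷ … ∷ λ_ℓ ∷ []  (largest first).

pairOk : ℕ → ℕ → Bool
pairOk x y = (y ≤ᵇ x) ∧ (if x ≤ᵇ suc y then ((x + y) % 3) ≡ᵇ 0 else true)

-- the defining conditions of 𝒫_{T_I} (parts ≥ 1 is implied by smallestOk below):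
--   weakly decreasing, λᵢ - λᵢ₊₂ ≥ 3, and the pair condition above
isTI : List ℕ → Bool
isTI [] = true
isTI (x ∷ []) = true
isTI (x ∷ y ∷ []) = pairOk x y
isTI (x ∷ y ∷ z ∷ r) = pairOk x y ∧ ((z + 3) ≤ᵇ x) ∧ isTI (y ∷ z ∷ r)

allAtLeast2 : List ℕ → Bool
allAtLeast2 [] = true
allAtLeast2 (x ∷ r) = (2 ≤ᵇ x) ∧ allAtLeast2 r

allLists : ℕ → ℕ → List (List ℕ)
allLists zero b = [] ∷ []
allLists (suc a) b = concatMap (λ x → map (x ∷_) (allLists a b)) (upTo b)

counted : ℕ → List ℕ → Bool
counted n l = isTI l ∧ allAtLeast2 l ∧ (sum l ≡ᵇ n)

-- g a n = coefficient of x^a q^n in G(x,q)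
--       = number of λ ∈ 𝒫_{T_I} with smallest part ≥ 2, a parts and |λ| = n.
-- (Every part of such λ is ≤ n, so enumerating lists with entries < n+1 is exhaustive.)
g : ℕ → ℕ → ℕ
g a n = length (filter (λ l → counted n l ≟ true) (allLists a (suc n)))

-- Formal power series in x, q with integer coefficients, given by their
-- coefficient functions  (a n : ℕ) ↦ [x^a q^n].

Series : Set
Series = ℕ → ℕ → ℤ

-- G(x q^k):  [x^a q^n] G(x q^k) = g a (n - k a)  if k a ≤ n, else 0
Gshift : ℕ → Series
Gshift k a n = if (k * a) ≤ᵇ n then + (g a (n ∸ (k * a))) else + 0

-- a polynomial in x, q as a list of monomials  c · x^i q^j  written (c , i , j)
Poly : Set
Poly = List (ℤ × ℕ × ℕ)

-- [x^a q^n] (x^i q^j · F)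
monoShift : ℕ → ℕ → Series → Series
monoShift i j F a n = if (i ≤ᵇ a) ∧ (j ≤ᵇ n) then F (a ∸ i) (n ∸ j) else + 0

_·_ : Poly → Series → Series
[] · F = λ a n → + 0
((c , i , j) ∷ p) · F = λ a n → c ℤ.* monoShift i j F a n ℤ.+ (p · F) a n

_⊕_ : Series → Series → Series
(F ⊕ H) a n = F a n ℤ.+ H a n

infixl 6 _⊕_
infixr 7 _·_

p0 : Poly
p0 = (+ 1 , 0 , 0) ∷ (+ 1 , 1 , 5) ∷ (+ 1 , 1 , 8) ∷ []

p3 : Poly
p3 = (- + 1 , 0 , 0)
   ∷ (- + 1 , 1 , 2) ∷ (- + 1 , 1 , 3) ∷ (- + 1 , 1 , 4) ∷ (- + 1 , 1 , 5) ∷ (- + 1 , 1 , 8)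
   ∷ (- + 2 , 2 , 6) ∷ (- + 1 , 2 , 7) ∷ (- + 1 , 2 , 8) ∷ (- + 1 , 2 , 9)
   ∷ (- + 1 , 2 , 10) ∷ (- + 1 , 2 , 11) ∷ (- + 1 , 2 , 12)
   ∷ (- + 1 , 3 , 11) ∷ (- + 2 , 3 , 14) ∷ (- + 1 , 3 , 17) ∷ []

p6 : Poly
p6 = (+ 1 , 3 , 16) ∷ (+ 1 , 3 , 17)
   ∷ (- + 1 , 4 , 17) ∷ (+ 1 , 4 , 18) ∷ (+ 1 , 4 , 19) ∷ (+ 1 , 4 , 21)
   ∷ (+ 1 , 4 , 22) ∷ (+ 1 , 4 , 23) ∷ (+ 1 , 4 , 24)
   ∷ (+ 1 , 5 , 26) ∷ (+ 1 , 5 , 29) ∷ []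

p9 : Poly
p9 = (+ 1 , 5 , 33) ∷ (+ 1 , 6 , 35) ∷ (+ 1 , 6 , 38) ∷ []

module Submission where

-- The recurrence for G(x) = Σ x^♯λ q^|λ| is proved by turning it into an
-- identity between finitely many explicit counting functions.
--
-- 1. Reading a partition from its smallest part upwards, the conditions
--    defining 𝒫_{T_I} are local: each new part y must satisfy
--    pairOk y u with the previous part u and be ≥ u' + 3 for the part u'
--    before that.  Hence g a n = B 2 a n, where
--      B m a n   counts such rising sequences with first part ≥ m, and
--      K L u a n counts continuations of a rising sequence whose last part
--                is u and whose next part must be ≥ L.
-- 2. K and B satisfy four elementary relations (peel off the smallest
--    admissible next part; a lower bound L ≤ u is irrelevant; if L ≥ u + 3
--    the previous part is irrelevant), and adding 3 to every part shows
--    B (m + 3) a n = B m a (n - 3a), i.e. G(x q^{3k}) = B (2 + 3k).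
-- 3. The theorem is then a formal consequence: the left-hand side is an
--    integer combination of shifted B's, and an explicit certificate (a
--    combination of shifted instances of the four relations) cancels it
--    exactly, which is checked by normalising formal linear combinations.

open import Defs
open import Relation.Binary.PropositionalEquality

module BooleanTests where

  open ≡-Reasoning
  open import Data.Nat using (zero; suc; _+_; _∸_; _≤ᵇ_; _≡ᵇ_; _<_; _≤_)
  open import Data.Nat.Properties using (≤ᵇ⇒≤; ≤⇒≤ᵇ; ≡ᵇ⇒≡; <⇒≱; ≰⇒>)
  open import Data.Bool using (Bool; true; false; _∧_; T)
  open import Data.Empty using (⊥; ⊥-elim)
  open import Relation.Nullary using (¬_)

  T⇒≡true : ∀ {b} → T b → b ≡ true
  T⇒≡true {true} _ = refl

  ≡true⇒T : ∀ {b} → b ≡ true → T b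
  ≡true⇒T refl = _

  ≤ᵇ-sound : ∀ m n → (m ≤ᵇ n) ≡ true → m ≤ n
  ≤ᵇ-sound m n e = ≤ᵇ⇒≤ m n (≡true⇒T e)

  ≤ᵇ-true : ∀ m n → m ≤ n → (m ≤ᵇ n) ≡ true
  ≤ᵇ-true m n m≤n = T⇒≡true (≤⇒≤ᵇ m≤n)

  ≤ᵇ-false⇒> : ∀ m n → (m ≤ᵇ n) ≡ false → n < m
  ≤ᵇ-false⇒> m n m≰n = ≰⇒> (λ m≤n → case (trans (sym m≰n) (≤ᵇ-true m n m≤n)))
    where
    case : false ≡ true → ⊥
    case ()

  ≤ᵇ-false : ∀ m n → n < m → (m ≤ᵇ n) ≡ false
  ≤ᵇ-false m n n<m with m ≤ᵇ n in eq
  ... | false = refl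
  ... | true = ⊥-elim (<⇒≱ n<m (≤ᵇ-sound m n eq))

  ≤ᵇ-iff : ∀ a b c d → (a ≤ b → c ≤ d) → (c ≤ d → a ≤ b) → (a ≤ᵇ b) ≡ (c ≤ᵇ d)
  ≤ᵇ-iff a b c d to from with a ≤ᵇ b in e₁ | c ≤ᵇ d in e₂
  ... | true  | true  = refl
  ... | false | false = refl
  ... | true  | false = trans (sym (≤ᵇ-true c d (to (≤ᵇ-sound a b e₁)))) e₂
  ... | false | true  = trans (sym e₁) (≤ᵇ-true a b (from (≤ᵇ-sound c d e₂)))

  ≡ᵇ-refl : ∀ n → (n ≡ᵇ n) ≡ true
  ≡ᵇ-refl zero = refl
  ≡ᵇ-refl (suc n) = ≡ᵇ-refl n

  ≡ᵇ-false : ∀ m n → ¬ m ≡ n → (m ≡ᵇ n) ≡ false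
  ≡ᵇ-false m n m≢n with m ≡ᵇ n in eq
  ... | false = refl
  ... | true = ⊥-elim (m≢n (≡ᵇ⇒≡ m n (≡true⇒T eq)))

  ≤ᵇ-suc : ∀ a b → (suc a ≤ᵇ suc b) ≡ (a ≤ᵇ b)
  ≤ᵇ-suc zero b = refl
  ≤ᵇ-suc (suc a) b = refl

  ≤ᵇ-+ : ∀ i i' a → (i + i' ≤ᵇ a) ≡ (i ≤ᵇ a) ∧ (i' ≤ᵇ a ∸ i)
  ≤ᵇ-+ zero i' a = refl
  ≤ᵇ-+ (suc i) i' zero = refl
  ≤ᵇ-+ (suc i) i' (suc a) = begin
    (suc (i + i') ≤ᵇ suc a)             ≡⟨ ≤ᵇ-suc (i + i') a ⟩
    (i + i' ≤ᵇ a)                       ≡⟨ ≤ᵇ-+ i i' a ⟩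
    (i ≤ᵇ a) ∧ (i' ≤ᵇ a ∸ i)            ≡⟨ cong (_∧ (i' ≤ᵇ a ∸ i)) (sym (≤ᵇ-suc i a)) ⟩
    (suc i ≤ᵇ suc a) ∧ (i' ≤ᵇ a ∸ i)    ∎

  ≡ᵇ-+ : ∀ y s n → (y + s ≡ᵇ n) ≡ (y ≤ᵇ n) ∧ (s ≡ᵇ n ∸ y)
  ≡ᵇ-+ zero s n = refl
  ≡ᵇ-+ (suc y) s zero = refl
  ≡ᵇ-+ (suc zero) s (suc n) = ≡ᵇ-+ zero s n
  ≡ᵇ-+ (suc (suc y)) s (suc n) = ≡ᵇ-+ (suc y) s n

module FiniteSums where

  open ≡-Reasoning
  open import Data.Nat using (ℕ; zero; suc; _+_; _<_)
  open import Data.Nat.Properties using (m<n⇒m<1+n; ≤-refl; +-identityʳ; +-suc; +-assoc; +-comm)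
  open import Data.List using (List; []; _∷_; applyUpTo)
  open import Function using (_∘_)

  sumTo : ℕ → (ℕ → ℕ) → ℕ
  sumTo zero f = 0
  sumTo (suc N) f = sumTo N f + f N

  sumTo-cong< : ∀ N {f h : ℕ → ℕ} → (∀ y → y < N → f y ≡ h y) → sumTo N f ≡ sumTo N h
  sumTo-cong< zero eq = refl
  sumTo-cong< (suc N) eq = cong₂ _+_ (sumTo-cong< N (λ y y<N → eq y (m<n⇒m<1+n y<N))) (eq N ≤-refl)

  sumTo-cong : ∀ N {f h : ℕ → ℕ} → (∀ y → f y ≡ h y) → sumTo N f ≡ sumTo N h
  sumTo-cong N eq = sumTo-cong< N (λ y _ → eq y)

  sumTo-vanishes : ∀ N (f : ℕ → ℕ) → (∀ y → y < N → f y ≡ 0) → sumTo N f ≡ 0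
  sumTo-vanishes zero f eq = refl
  sumTo-vanishes (suc N) f eq =
    cong₂ _+_ (sumTo-vanishes N f (λ y y<N → eq y (m<n⇒m<1+n y<N))) (eq N ≤-refl)

  sumTo-+ : ∀ N (f h : ℕ → ℕ) → sumTo N (λ y → f y + h y) ≡ sumTo N f + sumTo N h
  sumTo-+ zero f h = refl
  sumTo-+ (suc N) f h = begin
    sumTo N (λ y → f y + h y) + (f N + h N) ≡⟨ cong (_+ (f N + h N)) (sumTo-+ N f h) ⟩
    (sumTo N f + sumTo N h) + (f N + h N)   ≡⟨ interchange (sumTo N f) (sumTo N h) (f N) (h N) ⟩
    (sumTo N f + f N) + (sumTo N h + h N)   ∎
    where
    interchange : ∀ a b c d → (a + b) + (c + d) ≡ (a + c) + (b + d)
    interchange a b c d = begin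
      (a + b) + (c + d) ≡⟨ +-assoc a b (c + d) ⟩
      a + (b + (c + d)) ≡⟨ cong (a +_) (sym (+-assoc b c d)) ⟩
      a + ((b + c) + d) ≡⟨ cong (λ z → a + (z + d)) (+-comm b c) ⟩
      a + ((c + b) + d) ≡⟨ cong (a +_) (+-assoc c b d) ⟩
      a + (c + (b + d)) ≡⟨ sym (+-assoc a c (b + d)) ⟩
      (a + c) + (b + d) ∎

  sumTo-swap : ∀ N M (f : ℕ → ℕ → ℕ) →
    sumTo N (λ x → sumTo M (f x)) ≡ sumTo M (λ y → sumTo N (λ x → f x y))
  sumTo-swap zero M f = sym (sumTo-vanishes M (λ _ → 0) (λ _ _ → refl))
  sumTo-swap (suc N) M f = begin
    sumTo N (λ x → sumTo M (f x)) + sumTo M (f N)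
      ≡⟨ cong (_+ sumTo M (f N)) (sumTo-swap N M f) ⟩
    sumTo M (λ y → sumTo N (λ x → f x y)) + sumTo M (f N)
      ≡⟨ sym (sumTo-+ M (λ y → sumTo N (λ x → f x y)) (f N)) ⟩
    sumTo M (λ y → sumTo N (λ x → f x y) + f N y) ∎

  sumTo-split : ∀ k N (f : ℕ → ℕ) → sumTo (k + N) f ≡ sumTo k f + sumTo N (λ y → f (k + y))
  sumTo-split k zero f = trans (cong (λ z → sumTo z f) (+-identityʳ k)) (sym (+-identityʳ _))
  sumTo-split k (suc N) f = begin
    sumTo (k + suc N) f                                  ≡⟨ cong (λ z → sumTo z f) (+-suc k N) ⟩
    sumTo (suc (k + N)) f                                ≡⟨ cong (_+ f (k + N)) (sumTo-split k N f) ⟩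
    (sumTo k f + sumTo N (λ y → f (k + y))) + f (k + N)  ≡⟨ +-assoc (sumTo k f) _ _ ⟩
    sumTo k f + (sumTo N (λ y → f (k + y)) + f (k + N))  ∎

  sumOver : (ℕ → ℕ) → List ℕ → ℕ
  sumOver f [] = 0
  sumOver f (x ∷ xs) = f x + sumOver f xs

  sumOver-applyUpTo : ∀ N (e f : ℕ → ℕ) → sumOver f (applyUpTo e N) ≡ sumTo N (f ∘ e)
  sumOver-applyUpTo zero e f = refl
  sumOver-applyUpTo (suc N) e f =
    trans (cong (f (e 0) +_) (sumOver-applyUpTo N (e ∘ suc) f)) (sym (sumTo-split 1 N (f ∘ e)))

module Counting where

  open ≡-Reasoning
  open FiniteSums
  open import Data.Nat using (ℕ; zero; suc; _+_)
  open import Data.Nat.Properties using (+-assoc)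
  open import Data.Bool using (Bool; true; false; if_then_else_; _≟_)
  open import Data.List using (List; []; _∷_; length; filter; map; concatMap; concat; upTo; _++_; reverse)
  open import Data.List.Properties using (reverse-++)
  open import Function using (_∘_)

  ⟦_⟧ : Bool → ℕ
  ⟦ true ⟧ = 1
  ⟦ false ⟧ = 0

  countIn : (List ℕ → Bool) → List (List ℕ) → ℕ
  countIn P [] = 0
  countIn P (x ∷ xs) = ⟦ P x ⟧ + countIn P xs

  length-filter : ∀ (P : List ℕ → Bool) xs → length (filter (λ l → P l ≟ true) xs) ≡ countIn P xs
  length-filter P [] = refl
  length-filter P (x ∷ xs) with P x
  ... | true = cong suc (length-filter P xs)
  ... | false = length-filter P xs

  countIn-++ : ∀ P xs ys → countIn P (xs ++ ys) ≡ countIn P xs + countIn P ys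
  countIn-++ P [] ys = refl
  countIn-++ P (x ∷ xs) ys = trans (cong (⟦ P x ⟧ +_) (countIn-++ P xs ys)) (sym (+-assoc ⟦ P x ⟧ _ _))

  countIn-map : ∀ P (f : List ℕ → List ℕ) xs → countIn P (map f xs) ≡ countIn (P ∘ f) xs
  countIn-map P f [] = refl
  countIn-map P f (x ∷ xs) = cong (⟦ P (f x) ⟧ +_) (countIn-map P f xs)

  countIn-concatMap : ∀ P (h : ℕ → List (List ℕ)) xs →
    countIn P (concatMap h xs) ≡ sumOver (λ x → countIn P (h x)) xs
  countIn-concatMap P h [] = refl
  countIn-concatMap P h (x ∷ xs) =
    trans (countIn-++ P (h x) (concat (map h xs))) (cong (countIn P (h x) +_) (countIn-concatMap P h xs))

  countLists : ℕ → ℕ → (List ℕ → Bool) → ℕ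
  countLists a b P = countIn P (allLists a b)

  countLists-cong : ∀ a b {P Q} → (∀ l → P l ≡ Q l) → countLists a b P ≡ countLists a b Q
  countLists-cong a b {P} {Q} eq = go (allLists a b)
    where
    go : ∀ xs → countIn P xs ≡ countIn Q xs
    go [] = refl
    go (x ∷ xs) = cong₂ _+_ (cong ⟦_⟧ (eq x)) (go xs)

  countLists-false : ∀ a b → countLists a b (λ _ → false) ≡ 0
  countLists-false a b = go (allLists a b)
    where
    go : ∀ xs → countIn (λ _ → false) xs ≡ 0
    go [] = refl
    go (x ∷ xs) = go xs

  countLists-if : ∀ a b (c : Bool) Q →
    countLists a b (λ l → if c then Q l else false) ≡ (if c then countLists a b Q else 0)
  countLists-if a b true Q = refl
  countLists-if a b false Q = countLists-false a b

  countLists-cons : ∀ a b P → countLists (suc a) b P ≡ sumTo b (λ x → countLists a b (λ l → P (x ∷ l)))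
  countLists-cons a b P = begin
    countIn P (concatMap (λ x → map (x ∷_) (allLists a b)) (upTo b))
      ≡⟨ countIn-concatMap P _ (upTo b) ⟩
    sumOver (λ x → countIn P (map (x ∷_) (allLists a b))) (upTo b)
      ≡⟨ sumOver-applyUpTo b (λ x → x) _ ⟩
    sumTo b (λ x → countIn P (map (x ∷_) (allLists a b)))
      ≡⟨ sumTo-cong b (λ x → countIn-map P (x ∷_) (allLists a b)) ⟩
    sumTo b (λ x → countLists a b (λ l → P (x ∷ l))) ∎

  countLists-snoc : ∀ a b P → countLists (suc a) b P ≡ sumTo b (λ x → countLists a b (λ l → P (l ++ x ∷ [])))
  countLists-snoc zero b P = countLists-cons zero b P
  countLists-snoc (suc a) b P = begin
    countLists (suc (suc a)) b P
      ≡⟨ countLists-cons (suc a) b P ⟩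
    sumTo b (λ x → countLists (suc a) b (λ l → P (x ∷ l)))
      ≡⟨ sumTo-cong b (λ x → countLists-snoc a b (λ l → P (x ∷ l))) ⟩
    sumTo b (λ x → sumTo b (λ y → countLists a b (λ l → P (x ∷ (l ++ y ∷ [])))))
      ≡⟨ sumTo-swap b b _ ⟩
    sumTo b (λ y → sumTo b (λ x → countLists a b (λ l → P ((x ∷ l) ++ y ∷ []))))
      ≡⟨ sumTo-cong b (λ y → sym (countLists-cons a b (λ l → P (l ++ y ∷ [])))) ⟩
    sumTo b (λ y → countLists (suc a) b (λ l → P (l ++ y ∷ []))) ∎

  -- the family allLists a b is closed under reversal
  countLists-reverse : ∀ a b P → countLists a b P ≡ countLists a b (P ∘ reverse)
  countLists-reverse zero b P = refl
  countLists-reverse (suc a) b P = begin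
    countLists (suc a) b P
      ≡⟨ countLists-cons a b P ⟩
    sumTo b (λ x → countLists a b (λ l → P (x ∷ l)))
      ≡⟨ sumTo-cong b (λ x → countLists-reverse a b (λ l → P (x ∷ l))) ⟩
    sumTo b (λ x → countLists a b (λ l → P (x ∷ reverse l)))
      ≡⟨ sumTo-cong b (λ x → countLists-cong a b (λ l → cong P (sym (reverse-++ l (x ∷ []))))) ⟩
    sumTo b (λ x → countLists a b (λ l → P (reverse (l ++ x ∷ []))))
      ≡⟨ sym (countLists-snoc a b (P ∘ reverse)) ⟩
    countLists (suc a) b (P ∘ reverse) ∎

  g-as-count : ∀ a n → g a n ≡ countLists a (suc n) (counted n)
  g-as-count a n = length-filter (counted n) (allLists a (suc n))

-- The defining
-- conditions of 𝒫_{T_I} then become a left-to-right scan in which each new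
-- part y only has to be compared with the previous part u and with the
-- bound L = (the part before u) + 3 coming from λᵢ - λᵢ₊₂ ≥ 3.
module RisingReading where

  open ≡-Reasoning
  open BooleanTests
  open import Data.Nat using (ℕ; _+_; _≤ᵇ_; _≡ᵇ_)
  open import Data.Nat.Properties using (+-identityʳ; +-comm; ≤-trans)
  open import Data.Bool using (Bool; true; false; _∧_)
  open import Data.Bool.Properties using (∧-identityʳ; ∧-zeroʳ)
  open import Data.List using (List; []; _∷_; _++_; reverse)
  open import Data.List.Properties using (unfold-reverse; ++-assoc)
  open import Data.Nat.ListAction using (sum)
  open import Data.Nat.ListAction.Properties using (sum-++)

  -- risingOk L u r: the parts r can follow the previous part u, the next
  -- part being subject to the lower bound L
  risingOk : ℕ → ℕ → List ℕ → Bool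
  risingOk L u [] = true
  risingOk L u (y ∷ r) = (pairOk y u ∧ (L ≤ᵇ y)) ∧ risingOk (u + 3) y r

  -- the lower bound that the head of a decreasing list imposes two steps down
  gapBound : List ℕ → ℕ
  gapBound [] = 0
  gapBound (t ∷ _) = t + 3

  isTI-cons₂ : ∀ y s acc → isTI (y ∷ s ∷ acc) ≡ pairOk y s ∧ (gapBound acc ≤ᵇ y) ∧ isTI (s ∷ acc)
  isTI-cons₂ y s [] = sym (∧-identityʳ (pairOk y s))
  isTI-cons₂ y s (t ∷ r) = refl

  isTI-reverse : ∀ r s acc → isTI (reverse r ++ s ∷ acc) ≡ isTI (s ∷ acc) ∧ risingOk (gapBound acc) s r
  isTI-reverse [] s acc = sym (∧-identityʳ _)
  isTI-reverse (y ∷ r) s acc = begin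
    isTI (reverse (y ∷ r) ++ s ∷ acc)
      ≡⟨ cong isTI (trans (cong (_++ s ∷ acc) (unfold-reverse y r)) (++-assoc (reverse r) (y ∷ []) (s ∷ acc))) ⟩
    isTI (reverse r ++ y ∷ s ∷ acc)
      ≡⟨ isTI-reverse r y (s ∷ acc) ⟩
    isTI (y ∷ s ∷ acc) ∧ risingOk (s + 3) y r
      ≡⟨ cong (_∧ risingOk (s + 3) y r) (isTI-cons₂ y s acc) ⟩
    (pairOk y s ∧ (gapBound acc ≤ᵇ y) ∧ isTI (s ∷ acc)) ∧ risingOk (s + 3) y r
      ≡⟨ rotate (pairOk y s) (gapBound acc ≤ᵇ y) (isTI (s ∷ acc)) (risingOk (s + 3) y r) ⟩
    isTI (s ∷ acc) ∧ risingOk (gapBound acc) s (y ∷ r) ∎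
    where
    rotate : ∀ a b c d → (a ∧ b ∧ c) ∧ d ≡ c ∧ ((a ∧ b) ∧ d)
    rotate true  true  c     d = refl
    rotate true  false true  d = refl
    rotate true  false false d = refl
    rotate false b     true  d = refl
    rotate false b     false d = refl

  allAtLeast2-++ : ∀ xs ys → allAtLeast2 (xs ++ ys) ≡ allAtLeast2 xs ∧ allAtLeast2 ys
  allAtLeast2-++ [] ys = refl
  allAtLeast2-++ (x ∷ xs) ys with 2 ≤ᵇ x
  ... | true = allAtLeast2-++ xs ys
  ... | false = refl

  allAtLeast2-reverse : ∀ l → allAtLeast2 (reverse l) ≡ allAtLeast2 l
  allAtLeast2-reverse [] = refl
  allAtLeast2-reverse (x ∷ l) = begin
    allAtLeast2 (reverse (x ∷ l))             ≡⟨ cong allAtLeast2 (unfold-reverse x l) ⟩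
    allAtLeast2 (reverse l ++ x ∷ [])         ≡⟨ allAtLeast2-++ (reverse l) (x ∷ []) ⟩
    allAtLeast2 (reverse l) ∧ ((2 ≤ᵇ x) ∧ true) ≡⟨ cong (_∧ ((2 ≤ᵇ x) ∧ true)) (allAtLeast2-reverse l) ⟩
    allAtLeast2 l ∧ ((2 ≤ᵇ x) ∧ true)         ≡⟨ swap (allAtLeast2 l) (2 ≤ᵇ x) ⟩
    allAtLeast2 (x ∷ l)                       ∎
    where
    swap : ∀ a b → a ∧ (b ∧ true) ≡ b ∧ a
    swap a true = ∧-identityʳ a
    swap a false = ∧-zeroʳ a

  sum-reverse : ∀ l → sum (reverse l) ≡ sum l
  sum-reverse [] = refl
  sum-reverse (x ∷ l) = begin
    sum (reverse (x ∷ l))     ≡⟨ cong sum (unfold-reverse x l) ⟩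
    sum (reverse l ++ x ∷ []) ≡⟨ sum-++ (reverse l) (x ∷ []) ⟩
    sum (reverse l) + (x + 0) ≡⟨ cong₂ _+_ (sum-reverse l) (+-identityʳ x) ⟩
    sum l + x                 ≡⟨ +-comm (sum l) x ⟩
    sum (x ∷ l)               ∎

  pairOk⇒≥ : ∀ y u → pairOk y u ≡ true → (u ≤ᵇ y) ≡ true
  pairOk⇒≥ y u ok with u ≤ᵇ y
  ... | true = refl
  ... | false = ok

  risingOk⇒allAtLeast2 : ∀ L u r → risingOk L u r ≡ true → (2 ≤ᵇ u) ≡ true → allAtLeast2 r ≡ true
  risingOk⇒allAtLeast2 L u [] ok u≥2 = refl
  risingOk⇒allAtLeast2 L u (y ∷ r) ok u≥2 with pairOk y u in p | L ≤ᵇ y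
  ... | true | true with y≥2 ← ≤ᵇ-true 2 y (≤-trans (≤ᵇ-sound 2 u u≥2) (≤ᵇ-sound u y (pairOk⇒≥ y u p)))
                    rewrite y≥2 = risingOk⇒allAtLeast2 (u + 3) y r ok y≥2
  risingOk⇒allAtLeast2 L u (y ∷ r) () u≥2 | true | false
  risingOk⇒allAtLeast2 L u (y ∷ r) () u≥2 | false | _

  risingCounted : ℕ → List ℕ → Bool
  risingCounted n [] = 0 ≡ᵇ n
  risingCounted n (s ∷ r) = ((2 ≤ᵇ s) ∧ risingOk 0 s r) ∧ (s + sum r ≡ᵇ n)

  counted-reverse : ∀ n l → counted n (reverse l) ≡ risingCounted n l
  counted-reverse n [] = refl
  counted-reverse n (s ∷ r) = begin
    isTI (reverse (s ∷ r)) ∧ allAtLeast2 (reverse (s ∷ r)) ∧ (sum (reverse (s ∷ r)) ≡ᵇ n)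
      ≡⟨ cong₂ (λ p q → p ∧ q ∧ (sum (reverse (s ∷ r)) ≡ᵇ n))
               (cong isTI (unfold-reverse s r)) (allAtLeast2-reverse (s ∷ r)) ⟩
    isTI (reverse r ++ s ∷ []) ∧ allAtLeast2 (s ∷ r) ∧ (sum (reverse (s ∷ r)) ≡ᵇ n)
      ≡⟨ cong₂ (λ p q → p ∧ allAtLeast2 (s ∷ r) ∧ (q ≡ᵇ n)) (isTI-reverse r s []) (sum-reverse (s ∷ r)) ⟩
    risingOk 0 s r ∧ ((2 ≤ᵇ s) ∧ allAtLeast2 r) ∧ (s + sum r ≡ᵇ n)
      ≡⟨ drop-implied (risingOk 0 s r) (2 ≤ᵇ s) (allAtLeast2 r) _ (risingOk⇒allAtLeast2 0 s r) ⟩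
    risingCounted n (s ∷ r) ∎
    where
    drop-implied : ∀ c t a e → (c ≡ true → t ≡ true → a ≡ true) → c ∧ (t ∧ a) ∧ e ≡ (t ∧ c) ∧ e
    drop-implied false true a e _ = refl
    drop-implied false false a e _ = refl
    drop-implied true false a e _ = refl
    drop-implied true true a e implied rewrite implied refl refl = refl

module CountingFunctions where

  open ≡-Reasoning
  open BooleanTests
  open FiniteSums
  open Counting
  open RisingReading
  open import Data.Nat using (ℕ; zero; suc; _+_; _∸_; _≤ᵇ_; _≡ᵇ_; _<_; _≤_; s≤s)
  open import Data.Nat.Properties using (≤-refl; ≤-pred; ≤-<-trans; m∸n≤m; m+[n∸m]≡n; m≤m+n; +-identityʳ)
  open import Data.Bool using (Bool; true; false; _∧_; if_then_else_)
  open import Data.Bool.Properties using (∧-identityʳ; ∧-zeroʳ)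
  open import Data.List using (List; _∷_; reverse)
  open import Data.Nat.ListAction using (sum)

  -- K L u a n: number of ways to continue a rising sequence whose last part
  -- is u by a further parts of total n, the next part being ≥ L
  K : ℕ → ℕ → ℕ → ℕ → ℕ
  K L u zero n = ⟦ 0 ≡ᵇ n ⟧
  K L u (suc a) n = sumTo (suc n) (λ y → if pairOk y u ∧ (L ≤ᵇ y) then K (u + 3) y a (n ∸ y) else 0)

  -- B m a n: number of rising sequences with a parts, total n, first part ≥ m
  B : ℕ → ℕ → ℕ → ℕ
  B m zero n = ⟦ 0 ≡ᵇ n ⟧
  B m (suc a) n = sumTo (suc n) (λ y → if m ≤ᵇ y then K 0 y a (n ∸ y) else 0)

  -- a first entry y > n cannot occur in a list of sum n, so the range of the
  -- first entry can be cut down from b to n + 1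
  sumTo-truncate : ∀ b n (c : ℕ → Bool) (h : ℕ → ℕ) → n < b →
    sumTo b (λ y → if c y ∧ (y ≤ᵇ n) then h y else 0) ≡ sumTo (suc n) (λ y → if c y then h y else 0)
  sumTo-truncate b n c h n<b = begin
    sumTo b F                                                    ≡⟨ cong (λ z → sumTo z F) (sym (m+[n∸m]≡n n<b)) ⟩
    sumTo (suc n + (b ∸ suc n)) F                                ≡⟨ sumTo-split (suc n) (b ∸ suc n) F ⟩
    sumTo (suc n) F + sumTo (b ∸ suc n) (λ y → F (suc n + y))
      ≡⟨ cong₂ _+_ (sumTo-cong< (suc n) in-range) (sumTo-vanishes (b ∸ suc n) _ out-of-range) ⟩
    sumTo (suc n) (λ y → if c y then h y else 0) + 0             ≡⟨ +-identityʳ _ ⟩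
    sumTo (suc n) (λ y → if c y then h y else 0)                 ∎
    where
    F : ℕ → ℕ
    F y = if c y ∧ (y ≤ᵇ n) then h y else 0
    in-range : ∀ y → y < suc n → F y ≡ (if c y then h y else 0)
    in-range y y<sn rewrite ≤ᵇ-true y n (≤-pred y<sn) | ∧-identityʳ (c y) = refl
    out-of-range : ∀ y → y < b ∸ suc n → F (suc n + y) ≡ 0
    out-of-range y _ rewrite ≤ᵇ-false (suc n + y) n (s≤s (m≤m+n n y)) | ∧-zeroʳ (c (suc n + y)) = refl

  first-entry : ∀ (c r : Bool) y l n →
    (c ∧ r) ∧ (y + sum l ≡ᵇ n) ≡ (if c ∧ (y ≤ᵇ n) then r ∧ (sum l ≡ᵇ n ∸ y) else false)
  first-entry c r y l n rewrite ≡ᵇ-+ y (sum l) n = factor c (y ≤ᵇ n)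
    where
    factor : ∀ c d → (c ∧ r) ∧ d ∧ (sum l ≡ᵇ n ∸ y) ≡ (if c ∧ d then r ∧ (sum l ≡ᵇ n ∸ y) else false)
    factor true true = refl
    factor true false = ∧-zeroʳ r
    factor false d = refl

  count-continuations : ∀ a L u n b → n < b →
    countLists a b (λ l → risingOk L u l ∧ (sum l ≡ᵇ n)) ≡ K L u a n
  count-continuations zero L u n b n<b = +-identityʳ _
  count-continuations (suc a) L u n b n<b = begin
    countLists (suc a) b P
      ≡⟨ countLists-cons a b P ⟩
    sumTo b (λ y → countLists a b (λ l → P (y ∷ l)))
      ≡⟨ sumTo-cong b by-first-entry ⟩
    sumTo b (λ y → if admissible y ∧ (y ≤ᵇ n) then K (u + 3) y a (n ∸ y) else 0)
      ≡⟨ sumTo-truncate b n admissible (λ y → K (u + 3) y a (n ∸ y)) n<b ⟩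
    K L u (suc a) n ∎
    where
    P : List ℕ → Bool
    P l = risingOk L u l ∧ (sum l ≡ᵇ n)
    admissible : ℕ → Bool
    admissible y = pairOk y u ∧ (L ≤ᵇ y)
    by-first-entry : ∀ y → countLists a b (λ l → P (y ∷ l))
                         ≡ (if admissible y ∧ (y ≤ᵇ n) then K (u + 3) y a (n ∸ y) else 0)
    by-first-entry y = begin
      countLists a b (λ l → P (y ∷ l))
        ≡⟨ countLists-cong a b (λ l → first-entry (admissible y) (risingOk (u + 3) y l) y l n) ⟩
      countLists a b (λ l → if admissible y ∧ (y ≤ᵇ n) then risingOk (u + 3) y l ∧ (sum l ≡ᵇ n ∸ y) else false)
        ≡⟨ countLists-if a b _ _ ⟩
      (if admissible y ∧ (y ≤ᵇ n) then countLists a b (λ l → risingOk (u + 3) y l ∧ (sum l ≡ᵇ n ∸ y)) else 0)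
        ≡⟨ cong (if admissible y ∧ (y ≤ᵇ n) then_else 0)
                (count-continuations a (u + 3) y (n ∸ y) b (≤-<-trans (m∸n≤m n y) n<b)) ⟩
      (if admissible y ∧ (y ≤ᵇ n) then K (u + 3) y a (n ∸ y) else 0) ∎

  count-rising : ∀ a n b → n < b → countLists a b (risingCounted n) ≡ B 2 a n
  count-rising zero n b n<b = +-identityʳ _
  count-rising (suc a) n b n<b = begin
    countLists (suc a) b (risingCounted n)
      ≡⟨ countLists-cons a b (risingCounted n) ⟩
    sumTo b (λ y → countLists a b (λ l → risingCounted n (y ∷ l)))
      ≡⟨ sumTo-cong b by-first-entry ⟩
    sumTo b (λ y → if (2 ≤ᵇ y) ∧ (y ≤ᵇ n) then K 0 y a (n ∸ y) else 0)
      ≡⟨ sumTo-truncate b n (2 ≤ᵇ_) (λ y → K 0 y a (n ∸ y)) n<b ⟩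
    B 2 (suc a) n ∎
    where
    by-first-entry : ∀ y → countLists a b (λ l → risingCounted n (y ∷ l))
                         ≡ (if (2 ≤ᵇ y) ∧ (y ≤ᵇ n) then K 0 y a (n ∸ y) else 0)
    by-first-entry y = begin
      countLists a b (λ l → risingCounted n (y ∷ l))
        ≡⟨ countLists-cong a b (λ l → first-entry (2 ≤ᵇ y) (risingOk 0 y l) y l n) ⟩
      countLists a b (λ l → if (2 ≤ᵇ y) ∧ (y ≤ᵇ n) then risingOk 0 y l ∧ (sum l ≡ᵇ n ∸ y) else false)
        ≡⟨ countLists-if a b _ _ ⟩
      (if (2 ≤ᵇ y) ∧ (y ≤ᵇ n) then countLists a b (λ l → risingOk 0 y l ∧ (sum l ≡ᵇ n ∸ y)) else 0)
        ≡⟨ cong (if (2 ≤ᵇ y) ∧ (y ≤ᵇ n) then_else 0)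
                (count-continuations a 0 y (n ∸ y) b (≤-<-trans (m∸n≤m n y) n<b)) ⟩
      (if (2 ≤ᵇ y) ∧ (y ≤ᵇ n) then K 0 y a (n ∸ y) else 0) ∎

  g≡B : ∀ a n → g a n ≡ B 2 a n
  g≡B a n = begin
    g a n                                              ≡⟨ g-as-count a n ⟩
    countLists a (suc n) (counted n)                   ≡⟨ countLists-reverse a (suc n) (counted n) ⟩
    countLists a (suc n) (λ l → counted n (reverse l)) ≡⟨ countLists-cong a (suc n) (counted-reverse n) ⟩
    countLists a (suc n) (risingCounted n)             ≡⟨ count-rising a n (suc n) ≤-refl ⟩
    B 2 a n                                            ∎

module Relations where

  open BooleanTests
  open FiniteSums
  open RisingReading using (pairOk⇒≥)
  open CountingFunctions
  open import Data.Nat using (ℕ; zero; suc; _+_; _*_; _∸_; _≤ᵇ_; _≡ᵇ_; _<_; _≤_)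
  open import Data.Nat.Properties
    using (≤-refl; ≤-pred; ≤-trans; <-trans; <⇒≤; <-irrefl; <-cmp; n<1+n; n≮0; m≤m+n; m∸n+n≡m;
           +-identityʳ; +-comm; +-cancelʳ-<; *-suc; *-zeroʳ; *-monoˡ-≤; +-monoˡ-≤; ≤-reflexive; n≤1+n)
  open import Data.Bool using (Bool; true; false; _∧_; if_then_else_)
  open import Data.Bool.Properties using (∧-identityʳ; ∧-zeroʳ)
  open import Data.Empty using (⊥-elim)
  open import Relation.Binary using (tri<; tri≈; tri>)

  sumTo-delta : ∀ n L v → sumTo (suc n) (λ y → if y ≡ᵇ L then v else 0) ≡ (if L ≤ᵇ n then v else 0)
  sumTo-delta zero zero v = refl
  sumTo-delta zero (suc L) v = refl
  sumTo-delta (suc n) L v with <-cmp L (suc n)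
  ... | tri< L<n _ _
    rewrite sumTo-delta n L v | ≤ᵇ-true L n (≤-pred L<n) | ≡ᵇ-false (suc n) L (λ e → <-irrefl (sym e) L<n)
          | ≤ᵇ-true L (suc n) (<⇒≤ L<n) = +-identityʳ v
  ... | tri≈ _ refl _
    rewrite sumTo-delta n (suc n) v | ≤ᵇ-false (suc n) n ≤-refl | ≡ᵇ-refl n | ≤ᵇ-true (suc n) (suc n) ≤-refl = refl
  ... | tri> _ _ n<L
    rewrite sumTo-delta n L v | ≤ᵇ-false L n (<-trans (n<1+n n) n<L) | ≡ᵇ-false (suc n) L (λ e → <-irrefl e n<L)
          | ≤ᵇ-false L (suc n) n<L = refl

  split-at : ∀ (c : ℕ → Bool) L (f : ℕ → ℕ) y →
    (if c y ∧ (L ≤ᵇ y) then f y else 0)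
      ≡ (if y ≡ᵇ L then (if c L then f L else 0) else 0) + (if c y ∧ (suc L ≤ᵇ y) then f y else 0)
  split-at c L f y with <-cmp y L
  ... | tri< y<L _ _
    rewrite ≤ᵇ-false L y y<L | ≤ᵇ-false (suc L) y (<-trans y<L (n<1+n L)) | ≡ᵇ-false y L (λ e → <-irrefl e y<L)
          | ∧-zeroʳ (c y) = refl
  ... | tri≈ _ refl _
    rewrite ≤ᵇ-true y y ≤-refl | ≤ᵇ-false (suc y) y ≤-refl | ≡ᵇ-refl y | ∧-zeroʳ (c y) | ∧-identityʳ (c y) =
      sym (+-identityʳ _)
  ... | tri> _ _ L<y
    rewrite ≤ᵇ-true L y (<⇒≤ L<y) | ≤ᵇ-true (suc L) y L<y | ≡ᵇ-false y L (λ e → <-irrefl (sym e) L<y) = refl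

  sumTo-peel : ∀ n (c : ℕ → Bool) L (f : ℕ → ℕ) →
    sumTo (suc n) (λ y → if c y ∧ (L ≤ᵇ y) then f y else 0)
      ≡ (if c L ∧ (L ≤ᵇ n) then f L else 0) + sumTo (suc n) (λ y → if c y ∧ (suc L ≤ᵇ y) then f y else 0)
  sumTo-peel n c L f = begin
    sumTo (suc n) (λ y → if c y ∧ (L ≤ᵇ y) then f y else 0)
      ≡⟨ sumTo-cong (suc n) (split-at c L f) ⟩
    sumTo (suc n) (λ y → (if y ≡ᵇ L then (if c L then f L else 0) else 0) + rest y)
      ≡⟨ sumTo-+ (suc n) _ rest ⟩
    sumTo (suc n) (λ y → if y ≡ᵇ L then (if c L then f L else 0) else 0) + sumTo (suc n) rest
      ≡⟨ cong (_+ sumTo (suc n) rest) (trans (sumTo-delta n L _) (nested-if (c L) (L ≤ᵇ n))) ⟩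
    (if c L ∧ (L ≤ᵇ n) then f L else 0) + sumTo (suc n) rest ∎
    where
    rest : ℕ → ℕ
    rest y = if c y ∧ (suc L ≤ᵇ y) then f y else 0
    nested-if : ∀ p q → (if q then (if p then f L else 0) else 0) ≡ (if p ∧ q then f L else 0)
    nested-if true q = refl
    nested-if false true = refl
    nested-if false false = refl
    open ≡-Reasoning

  B-peel : ∀ m a n → B m (suc a) n ≡ (if m ≤ᵇ n then K 0 m a (n ∸ m) else 0) + B (suc m) (suc a) n
  B-peel m a n = sumTo-peel n (λ _ → true) m (λ y → K 0 y a (n ∸ y))

  K-peel : ∀ L u a n →
    K L u (suc a) n ≡ (if pairOk L u ∧ (L ≤ᵇ n) then K (u + 3) L a (n ∸ L) else 0) + K (suc L) u (suc a) n
  K-peel L u a n = sumTo-peel n (λ y → pairOk y u) L (λ y → K (u + 3) y a (n ∸ y))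

  -- (lower bound)  a lower bound L ≤ u is implied by pairOk y u, hence irrelevant
  K-lower-bound : ∀ L u a n → L ≤ u → K L u a n ≡ K 0 u a n
  K-lower-bound L u zero n L≤u = refl
  K-lower-bound L u (suc a) n L≤u = sumTo-cong (suc n) bound-implied
    where
    bound-implied : ∀ y → (if pairOk y u ∧ (L ≤ᵇ y) then K (u + 3) y a (n ∸ y) else 0)
                        ≡ (if pairOk y u ∧ true then K (u + 3) y a (n ∸ y) else 0)
    bound-implied y with pairOk y u in ok
    ... | false = refl
    ... | true rewrite ≤ᵇ-true L y (≤-trans L≤u (≤ᵇ-sound u y (pairOk⇒≥ y u ok))) = refl

  pairOk-far : ∀ y u → u + 3 ≤ y → pairOk y u ≡ true
  pairOk-far y u u+3≤y
    rewrite ≤ᵇ-true u y (≤-trans (m≤m+n u 3) u+3≤y)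
          | ≤ᵇ-false y (suc u) (≤-trans (≤-trans (n≤1+n (2 + u)) (≤-reflexive (+-comm 3 u))) u+3≤y) = refl

  -- (free)  once L ≥ u + 3 every next part y ≥ L satisfies pairOk y u, so the
  -- continuation is just a rising partition with first part ≥ L
  K-free : ∀ L u a n → u + 3 ≤ L → K L u a n ≡ B L a n
  K-free L u zero n u+3≤L = refl
  K-free L u (suc a) n u+3≤L = sumTo-cong (suc n) pair-implied
    where
    pair-implied : ∀ y → (if pairOk y u ∧ (L ≤ᵇ y) then K (u + 3) y a (n ∸ y) else 0)
                       ≡ (if L ≤ᵇ y then K 0 y a (n ∸ y) else 0)
    pair-implied y with L ≤ᵇ y in L≤y
    ... | false rewrite ∧-zeroʳ (pairOk y u) = refl
    ... | true rewrite pairOk-far y u (≤-trans u+3≤L (≤ᵇ-sound L y L≤y)) =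
      K-lower-bound (u + 3) y a (n ∸ y) (≤-trans u+3≤L (≤ᵇ-sound L y L≤y))

  -- if every part is ≥ u then a + 1 parts weigh at least u (a + 1); after
  -- removing one part y ≥ u, the remaining a parts of total n - y fall short too
  weight-deficit : ∀ n y u a → y ≤ n → u ≤ y → n < u * suc a → n ∸ y < y * a
  weight-deficit n y u a y≤n u≤y n<u[1+a] =
    ≤-trans (+-cancelʳ-< y (n ∸ y) (u * a) rest+y<ua+y) (*-monoˡ-≤ a u≤y)
    where
    rest+y<ua+y : n ∸ y + y < u * a + y
    rest+y<ua+y = begin-strict
      n ∸ y + y   ≡⟨ m∸n+n≡m y≤n ⟩
      n           <⟨ n<u[1+a] ⟩
      u * suc a   ≡⟨ *-suc u a ⟩
      u + u * a   ≤⟨ +-monoˡ-≤ (u * a) u≤y ⟩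
      y + u * a   ≡⟨ +-comm y (u * a) ⟩
      u * a + y   ∎
      where open Data.Nat.Properties.≤-Reasoning

  K-vanishes : ∀ L u a n → n < u * a → K L u a n ≡ 0
  K-vanishes L u zero n n<0 rewrite *-zeroʳ u = ⊥-elim (n≮0 n<0)
  K-vanishes L u (suc a) n n<ua = sumTo-vanishes (suc n) _ term-vanishes
    where
    term-vanishes : ∀ y → y < suc n → (if pairOk y u ∧ (L ≤ᵇ y) then K (u + 3) y a (n ∸ y) else 0) ≡ 0
    term-vanishes y y<sn with pairOk y u in ok | L ≤ᵇ y
    ... | false | _ = refl
    ... | true | false = refl
    ... | true | true = K-vanishes (u + 3) y a (n ∸ y)
            (weight-deficit n y u a (≤-pred y<sn) (≤ᵇ-sound u y (pairOk⇒≥ y u ok)) n<ua)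

  B-vanishes : ∀ m a n → n < m * a → B m a n ≡ 0
  B-vanishes m zero n n<0 rewrite *-zeroʳ m = ⊥-elim (n≮0 n<0)
  B-vanishes m (suc a) n n<ma = sumTo-vanishes (suc n) _ term-vanishes
    where
    term-vanishes : ∀ y → y < suc n → (if m ≤ᵇ y then K 0 y a (n ∸ y) else 0) ≡ 0
    term-vanishes y y<sn with m ≤ᵇ y in m≤y
    ... | false = refl
    ... | true = K-vanishes 0 y a (n ∸ y) (weight-deficit n y m a (≤-pred y<sn) (≤ᵇ-sound m y m≤y) n<ma)

-- Adding 3 to every part: the conditions of 𝒫_{T_I} are invariant, so
-- B (m + 3) a n = B m a (n - 3a), and consequently G(x q^{3k}) = B (2 + 3k).
module Shift where

  open ≡-Reasoning
  open BooleanTests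
  open FiniteSums
  open CountingFunctions
  open Relations using (K-lower-bound; K-vanishes; B-vanishes)
  open import Data.Nat using (ℕ; zero; suc; _+_; _*_; _∸_; _≤ᵇ_; _%_; _<_; _≤_; z≤n; s≤s)
  open import Data.Nat.Properties
    using (≤-total; ≤-pred; ≤-<-trans; <-≤-trans; m≤m+n; m≤n+m; m∸n+n≡m; m≤n⇒m∸n≡0;
           +-comm; +-cancelʳ-<; +-∸-assoc; *-suc; *-monoˡ-≤; m+[n∸m]≡n; ∸-+-assoc; +-monoʳ-≤;
           m+n∸m≡n; ∸-monoˡ-≤)
  open import Data.Nat.DivMod using ([m+n]%n≡m%n)
  open import Data.Nat.Tactic.RingSolver using (solve-∀)
  open import Data.Bool using (Bool; true; false; _∧_; if_then_else_)
  open import Data.Bool.Properties using (∧-zeroʳ)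
  open import Data.Integer using (+_)
  open import Data.Sum using (inj₁; inj₂)

  ≤ᵇ-+3 : ∀ a b → (3 + a ≤ᵇ 3 + b) ≡ (a ≤ᵇ b)
  ≤ᵇ-+3 a b = trans (≤ᵇ-suc (2 + a) (2 + b)) (trans (≤ᵇ-suc (1 + a) (1 + b)) (≤ᵇ-suc a b))

  %3-+3 : ∀ x y → (3 + x + (3 + y)) % 3 ≡ (x + y) % 3
  %3-+3 x y = begin
    (3 + x + (3 + y)) % 3 ≡⟨ cong (_% 3) (regroup x y) ⟩
    ((x + y + 3) + 3) % 3 ≡⟨ [m+n]%n≡m%n (x + y + 3) 3 ⟩
    (x + y + 3) % 3       ≡⟨ [m+n]%n≡m%n (x + y) 3 ⟩
    (x + y) % 3           ∎
    where
    regroup : ∀ x y → 3 + x + (3 + y) ≡ x + y + 3 + 3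
    regroup = solve-∀

  pairOk-+3 : ∀ x y → pairOk (3 + x) (3 + y) ≡ pairOk x y
  pairOk-+3 x y rewrite ≤ᵇ-+3 y x | ≤ᵇ-+3 x (suc y) | %3-+3 x y = refl

  x∸k<c : ∀ x k c → 0 < c → x < k + c → x ∸ k < c
  x∸k<c x k c 0<c x<k+c with ≤-total k x
  ... | inj₁ k≤x = +-cancelʳ-< k (x ∸ k) c
                     (subst (_< c + k) (sym (m∸n+n≡m k≤x)) (subst (x <_) (+-comm k c) x<k+c))
  ... | inj₂ x≤k rewrite m≤n⇒m∸n≡0 x≤k = 0<c

  -- the first-part sum of a sequence with a + 1 parts, total 3(a+1) + n and
  -- first part ≥ 3, reindexed by y ↦ 3 + y: the first three terms are excluded
  -- by the condition c, and first parts above n + 3 leave too little weight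
  -- for the remaining a parts of size ≥ y
  sumTo-shift3 : ∀ a n (F : ℕ → ℕ → ℕ) (c : ℕ → Bool) →
    (∀ y → y < 3 → c y ≡ false) → (∀ y w → w < y * a → F y w ≡ 0) →
    sumTo (suc (3 * suc a + n)) (λ y → if c y then F y ((3 * suc a + n) ∸ y) else 0)
      ≡ sumTo (suc n) (λ y → if c (3 + y) then F (3 + y) (3 * a + (n ∸ y)) else 0)
  sumTo-shift3 a n F c c<3 F-small = begin
    sumTo (suc (3 * suc a + n)) H
      ≡⟨ cong (λ z → sumTo z H) (range a n) ⟩
    sumTo (3 + (suc n + 3 * a)) H
      ≡⟨ sumTo-split 3 (suc n + 3 * a) H ⟩
    sumTo 3 H + sumTo (suc n + 3 * a) (λ y → H (3 + y))
      ≡⟨ cong₂ _+_ (sumTo-vanishes 3 H below-3) (sumTo-split (suc n) (3 * a) (λ y → H (3 + y))) ⟩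
    0 + (sumTo (suc n) (λ y → H (3 + y)) + sumTo (3 * a) (λ y → H (3 + (suc n + y))))
      ≡⟨ cong₂ _+_ (sumTo-cong< (suc n) middle) (sumTo-vanishes (3 * a) _ too-large) ⟩
    sumTo (suc n) (λ y → if c (3 + y) then F (3 + y) (3 * a + (n ∸ y)) else 0) + 0
      ≡⟨ Data.Nat.Properties.+-identityʳ _ ⟩
    sumTo (suc n) (λ y → if c (3 + y) then F (3 + y) (3 * a + (n ∸ y)) else 0) ∎
    where
    H : ℕ → ℕ
    H y = if c y then F y ((3 * suc a + n) ∸ y) else 0
    range : ∀ a n → suc (3 * suc a + n) ≡ 3 + (suc n + 3 * a)
    range = solve-∀
    tail-range : ∀ a n y → 3 + (suc n + y) + 3 * a ≡ suc (3 * suc a + n) + y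
    tail-range = solve-∀
    below-3 : ∀ y → y < 3 → H y ≡ 0
    below-3 y y<3 rewrite c<3 y y<3 = refl
    remaining-weight : ∀ y → y ≤ n → (3 * suc a + n) ∸ (3 + y) ≡ 3 * a + (n ∸ y)
    remaining-weight y y≤n = begin
      (3 * suc a + n) ∸ (3 + y)   ≡⟨ cong (λ z → (z + n) ∸ (3 + y)) (*-suc 3 a) ⟩
      (3 + 3 * a + n) ∸ (3 + y)   ≡⟨ +-∸-assoc (3 * a) y≤n ⟩
      3 * a + (n ∸ y)             ∎
    middle : ∀ y → y < suc n → H (3 + y) ≡ (if c (3 + y) then F (3 + y) (3 * a + (n ∸ y)) else 0)
    middle y y<sn = cong (λ w → if c (3 + y) then F (3 + y) w else 0) (remaining-weight y (≤-pred y<sn))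
    too-large : ∀ y → y < 3 * a → H (3 + (suc n + y)) ≡ 0
    too-large y y<3a with c (3 + (suc n + y))
    ... | false = refl
    ... | true = F-small _ _ (<-≤-trans
            (x∸k<c (3 * suc a + n) (3 + (suc n + y)) (3 * a) (≤-<-trans z≤n y<3a)
               (subst (3 * suc a + n <_) (sym (tail-range a n y)) (s≤s (m≤m+n (3 * suc a + n) y))))
            (*-monoˡ-≤ a (m≤m+n 3 (suc n + y))))

  K-shift : ∀ a L u n → K (L + 3) (u + 3) a (3 * a + n) ≡ K L u a n
  K-shift zero L u n = refl
  K-shift (suc a) L u n = trans
    (sumTo-shift3 a n (λ y w → K (u + 3 + 3) y a w) (λ y → pairOk y (u + 3) ∧ (L + 3 ≤ᵇ y))
       (λ y y<3 → trans (cong (pairOk y (u + 3) ∧_) (≤ᵇ-false (L + 3) y (<-≤-trans y<3 (m≤n+m 3 L))))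
                        (∧-zeroʳ _))
       (λ y w → K-vanishes (u + 3 + 3) y a w))
    (sumTo-cong (suc n) shifted-term)
    where
    shifted-term : ∀ y →
      (if pairOk (3 + y) (u + 3) ∧ (L + 3 ≤ᵇ 3 + y) then K (u + 3 + 3) (3 + y) a (3 * a + (n ∸ y)) else 0)
        ≡ (if pairOk y u ∧ (L ≤ᵇ y) then K (u + 3) y a (n ∸ y) else 0)
    shifted-term y = cong₂ (λ b k → if b then k else 0)
      (cong₂ _∧_ (trans (cong (pairOk (3 + y)) (+-comm u 3)) (pairOk-+3 y u))
                 (trans (cong (_≤ᵇ 3 + y) (+-comm L 3)) (≤ᵇ-+3 L y)))
      (trans (cong (λ z → K (u + 3 + 3) z a (3 * a + (n ∸ y))) (+-comm 3 y)) (K-shift a (u + 3) y (n ∸ y)))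

  B-shift : ∀ a m n → B (m + 3) a (3 * a + n) ≡ B m a n
  B-shift zero m n = refl
  B-shift (suc a) m n = trans
    (sumTo-shift3 a n (λ y w → K 0 y a w) (λ y → m + 3 ≤ᵇ y)
       (λ y y<3 → ≤ᵇ-false (m + 3) y (<-≤-trans y<3 (m≤n+m 3 m)))
       (λ y w → K-vanishes 0 y a w))
    (sumTo-cong (suc n) shifted-term)
    where
    shifted-term : ∀ y → (if m + 3 ≤ᵇ 3 + y then K 0 (3 + y) a (3 * a + (n ∸ y)) else 0)
                       ≡ (if m ≤ᵇ y then K 0 y a (n ∸ y) else 0)
    shifted-term y = cong₂ (λ b k → if b then k else 0)
      (trans (cong (_≤ᵇ 3 + y) (+-comm m 3)) (≤ᵇ-+3 m y))
      (begin
        K 0 (3 + y) a (3 * a + (n ∸ y))       ≡⟨ sym (K-lower-bound 3 (3 + y) a _ (m≤m+n 3 y)) ⟩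
        K 3 (3 + y) a (3 * a + (n ∸ y))       ≡⟨ cong (λ z → K 3 z a (3 * a + (n ∸ y))) (+-comm 3 y) ⟩
        K (0 + 3) (y + 3) a (3 * a + (n ∸ y)) ≡⟨ K-shift a 0 y (n ∸ y) ⟩
        K 0 y a (n ∸ y)                       ∎)

  B-+3 : ∀ m a n → B (m + 3) a n ≡ (if 3 * a ≤ᵇ n then B m a (n ∸ 3 * a) else 0)
  B-+3 m a n with 3 * a ≤ᵇ n in 3a≤n
  ... | true = trans (cong (B (m + 3) a) (sym (m+[n∸m]≡n (≤ᵇ-sound (3 * a) n 3a≤n)))) (B-shift a m (n ∸ 3 * a))
  ... | false = B-vanishes (m + 3) a n (<-≤-trans (≤ᵇ-false⇒> (3 * a) n 3a≤n) (*-monoˡ-≤ a (m≤n+m 3 m)))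

  shift-compose : ∀ p q n (F : ℕ → ℕ) →
    (if p ≤ᵇ n then (if q ≤ᵇ n ∸ p then F (n ∸ p ∸ q) else 0) else 0) ≡ (if p + q ≤ᵇ n then F (n ∸ (p + q)) else 0)
  shift-compose p q n F with p ≤ᵇ n in p≤n
  ... | true rewrite ∸-+-assoc n p q
        | ≤ᵇ-iff q (n ∸ p) (p + q) n
            (λ q≤n-p → subst (p + q ≤_) (m+[n∸m]≡n (≤ᵇ-sound p n p≤n)) (+-monoʳ-≤ p q≤n-p))
            (λ p+q≤n → subst (_≤ n ∸ p) (m+n∸m≡n p q) (∸-monoˡ-≤ p p+q≤n)) = refl
  ... | false rewrite ≤ᵇ-false (p + q) n (<-≤-trans (≤ᵇ-false⇒> p n p≤n) (m≤m+n p q)) = refl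

  B-+3k : ∀ k a n → B (2 + 3 * k) a n ≡ (if 3 * k * a ≤ᵇ n then B 2 a (n ∸ 3 * k * a) else 0)
  B-+3k zero a n = refl
  B-+3k (suc k) a n = begin
    B (2 + 3 * suc k) a n
      ≡⟨ cong (λ z → B z a n) (step k) ⟩
    B ((2 + 3 * k) + 3) a n
      ≡⟨ B-+3 (2 + 3 * k) a n ⟩
    (if 3 * a ≤ᵇ n then B (2 + 3 * k) a (n ∸ 3 * a) else 0)
      ≡⟨ cong (if 3 * a ≤ᵇ n then_else 0) (B-+3k k a (n ∸ 3 * a)) ⟩
    (if 3 * a ≤ᵇ n then (if 3 * k * a ≤ᵇ n ∸ 3 * a then B 2 a (n ∸ 3 * a ∸ 3 * k * a) else 0) else 0)
      ≡⟨ shift-compose (3 * a) (3 * k * a) n (B 2 a) ⟩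
    (if 3 * a + 3 * k * a ≤ᵇ n then B 2 a (n ∸ (3 * a + 3 * k * a)) else 0)
      ≡⟨ cong (λ z → if z ≤ᵇ n then B 2 a (n ∸ z) else 0) (weight k a) ⟩
    (if 3 * suc k * a ≤ᵇ n then B 2 a (n ∸ 3 * suc k * a) else 0) ∎
    where
    step : ∀ k → 2 + 3 * suc k ≡ (2 + 3 * k) + 3
    step = solve-∀
    weight : ∀ k a → 3 * a + 3 * k * a ≡ 3 * suc k * a
    weight = solve-∀

  Gshift≡B : ∀ k a n → Gshift (3 * k) a n ≡ + B (2 + 3 * k) a n
  Gshift≡B k a n rewrite B-+3k k a n with 3 * k * a ≤ᵇ n
  ... | true = cong +_ (g≡B a (n ∸ 3 * k * a))
  ... | false = refl

module LinearCombinations where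

  open ≡-Reasoning
  open CountingFunctions using (K; B)
  open import Data.Nat as ℕ using (ℕ; zero; _∸_; _≤ᵇ_; _≡ᵇ_)
  open import Data.Nat.Properties using (≡ᵇ⇒≡; ∸-+-assoc)
  open import Data.Integer using (ℤ; +_; _+_; _*_)
  open import Data.Integer.Properties using (+-identityˡ; +-assoc; *-zeroʳ)
  open import Data.Integer.Tactic.RingSolver using (solve-∀)
  open import Data.Bool using (Bool; true; false; _∧_; if_then_else_)
  open import Data.List using (List; []; _∷_; _++_)
  open import Data.Product using (_×_; _,_)
  open BooleanTests using (≡true⇒T; ≤ᵇ-+)

  data Atom : Set where
    atomB : ℕ → Atom
    atomK : ℕ → ℕ → Atom

  ⟪_⟫ : Atom → Series
  ⟪ atomB m ⟫ a n = + B m a n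
  ⟪ atomK L u ⟫ a n = + K L u a n

  -- the term  c · x^i q^j · A
  data Term : Set where
    term : ℤ → ℕ → ℕ → Atom → Term

  eval : List Term → Series
  eval [] a n = + 0
  eval (term c i j A ∷ ts) a n = c * monoShift i j ⟪ A ⟫ a n + eval ts a n

  eval-++ : ∀ xs ys a n → eval (xs ++ ys) a n ≡ eval xs a n + eval ys a n
  eval-++ [] ys a n = sym (+-identityˡ _)
  eval-++ (term c i j A ∷ xs) ys a n =
    trans (cong (λ z → c * monoShift i j ⟪ A ⟫ a n + z) (eval-++ xs ys a n))
          (sym (+-assoc (c * monoShift i j ⟪ A ⟫ a n) (eval xs a n) (eval ys a n)))

  monoShift-cong : ∀ i j (F H : Series) → (∀ a n → F a n ≡ H a n) → ∀ a n → monoShift i j F a n ≡ monoShift i j H a n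
  monoShift-cong i j F H eq a n with (i ≤ᵇ a) ∧ (j ≤ᵇ n)
  ... | true = eq (a ∸ i) (n ∸ j)
  ... | false = refl

  monoShift-+ : ∀ i i' j j' (F : Series) a n →
    monoShift (i ℕ.+ i') (j ℕ.+ j') F a n ≡ (if (i ≤ᵇ a) ∧ (j ≤ᵇ n) then monoShift i' j' F (a ∸ i) (n ∸ j) else + 0)
  monoShift-+ i i' j j' F a n
    rewrite ≤ᵇ-+ i i' a | ≤ᵇ-+ j j' n | sym (∸-+-assoc a i i') | sym (∸-+-assoc n j j')
    = regroup (i ≤ᵇ a) (i' ≤ᵇ a ∸ i) (j ≤ᵇ n) (j' ≤ᵇ n ∸ j)
    where
    v : ℤ
    v = F (a ∸ i ∸ i') (n ∸ j ∸ j')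
    regroup : ∀ p p' r r' → (if (p ∧ p') ∧ (r ∧ r') then v else + 0)
                          ≡ (if p ∧ r then (if p' ∧ r' then v else + 0) else + 0)
    regroup true p' true r' = refl
    regroup true true false r' = refl
    regroup true false false r' = refl
    regroup false p' r r' = refl

  scale : ℤ → ℕ → ℕ → List Term → List Term
  scale c i j [] = []
  scale c i j (term d i' j' A ∷ ts) = term (c * d) (i ℕ.+ i') (j ℕ.+ j') A ∷ scale c i j ts

  eval-scale : ∀ c i j ts a n → eval (scale c i j ts) a n ≡ c * monoShift i j (eval ts) a n
  eval-scale c i j ts a n with (i ≤ᵇ a) ∧ (j ≤ᵇ n) in in-range
  ... | true = inside ts
    where
    inside : ∀ ts → eval (scale c i j ts) a n ≡ c * eval ts (a ∸ i) (n ∸ j)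
    inside [] = sym (*-zeroʳ c)
    inside (term d i' j' A ∷ ts) = begin
      c * d * monoShift (i ℕ.+ i') (j ℕ.+ j') ⟪ A ⟫ a n + eval (scale c i j ts) a n
        ≡⟨ cong₂ (λ x y → c * d * x + y)
                 (trans (monoShift-+ i i' j j' ⟪ A ⟫ a n)
                        (cong (if_then monoShift i' j' ⟪ A ⟫ (a ∸ i) (n ∸ j) else + 0) in-range))
                 (inside ts) ⟩
      c * d * monoShift i' j' ⟪ A ⟫ (a ∸ i) (n ∸ j) + c * eval ts (a ∸ i) (n ∸ j)
        ≡⟨ distrib c d _ _ ⟩
      c * (d * monoShift i' j' ⟪ A ⟫ (a ∸ i) (n ∸ j) + eval ts (a ∸ i) (n ∸ j)) ∎
      where
      distrib : ∀ c d x y → c * d * x + c * y ≡ c * (d * x + y)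
      distrib = solve-∀
  ... | false = trans (outside ts) (sym (*-zeroʳ c))
    where
    outside : ∀ ts → eval (scale c i j ts) a n ≡ + 0
    outside [] = refl
    outside (term d i' j' A ∷ ts) = begin
      c * d * monoShift (i ℕ.+ i') (j ℕ.+ j') ⟪ A ⟫ a n + eval (scale c i j ts) a n
        ≡⟨ cong₂ (λ x y → c * d * x + y)
                 (trans (monoShift-+ i i' j j' ⟪ A ⟫ a n)
                        (cong (if_then monoShift i' j' ⟪ A ⟫ (a ∸ i) (n ∸ j) else + 0) in-range))
                 (outside ts) ⟩
      c * d * + 0 + + 0 ≡⟨ cong (_+ + 0) (*-zeroʳ (c * d)) ⟩
      + 0 ∎

  sameAtom : Atom → Atom → Bool
  sameAtom (atomB m) (atomB m') = m ≡ᵇ m'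
  sameAtom (atomK L u) (atomK L' u') = (L ≡ᵇ L') ∧ (u ≡ᵇ u')
  sameAtom _ _ = false

  sameAtom-sound : ∀ A A' → sameAtom A A' ≡ true → A ≡ A'
  sameAtom-sound (atomB m) (atomB m') e = cong atomB (≡ᵇ⇒≡ m m' (≡true⇒T e))
  sameAtom-sound (atomK L u) (atomK L' u') e with L ≡ᵇ L' in e₁ | u ≡ᵇ u' in e₂
  ... | true | true = cong₂ atomK (≡ᵇ⇒≡ L L' (≡true⇒T e₁)) (≡ᵇ⇒≡ u u' (≡true⇒T e₂))
  sameAtom-sound (atomB _) (atomK _ _) ()
  sameAtom-sound (atomK _ _) (atomB _) ()

  sameKey : ℕ → ℕ → Atom → ℕ → ℕ → Atom → Bool
  sameKey i j A i' j' A' = (i ≡ᵇ i') ∧ (j ≡ᵇ j') ∧ sameAtom A A'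

  sameKey-sound : ∀ i j A i' j' A' → sameKey i j A i' j' A' ≡ true → i ≡ i' × j ≡ j' × A ≡ A'
  sameKey-sound i j A i' j' A' e with i ≡ᵇ i' in e₁ | j ≡ᵇ j' in e₂
  ... | true | true = ≡ᵇ⇒≡ i i' (≡true⇒T e₁) , ≡ᵇ⇒≡ j j' (≡true⇒T e₂) , sameAtom-sound A A' e

  isZero : ℤ → Bool
  isZero (+ zero) = true
  isZero _ = false

  isZero-sound : ∀ c → isZero c ≡ true → c ≡ + 0
  isZero-sound (+ zero) _ = refl

  insert : Term → List Term → List Term
  insert (term c i j A) [] = if isZero c then [] else term c i j A ∷ []
  insert (term c i j A) (term d i' j' A' ∷ ts) =
    if sameKey i j A i' j' A'
    then (if isZero (c + d) then ts else term (c + d) i' j' A' ∷ ts)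
    else term d i' j' A' ∷ insert (term c i j A) ts

  eval-insert : ∀ t ts a n → eval (insert t ts) a n ≡ eval (t ∷ ts) a n
  eval-insert (term c i j A) [] a n with isZero c in c≟0
  ... | true rewrite isZero-sound c c≟0 = refl
  ... | false = refl
  eval-insert (term c i j A) (term d i' j' A' ∷ ts) a n with sameKey i j A i' j' A' in same
  ... | false = begin
    d * X' + eval (insert (term c i j A) ts) a n ≡⟨ cong (λ z → d * X' + z) (eval-insert (term c i j A) ts a n) ⟩
    d * X' + (c * X + eval ts a n)               ≡⟨ exchange (d * X') (c * X) (eval ts a n) ⟩
    c * X + (d * X' + eval ts a n)               ∎
    where
    X X' : ℤ
    X = monoShift i j ⟪ A ⟫ a n
    X' = monoShift i' j' ⟪ A' ⟫ a n
    exchange : ∀ p q r → p + (q + r) ≡ q + (p + r)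
    exchange = solve-∀
  ... | true with sameKey-sound i j A i' j' A' same
  ... | refl , refl , refl with isZero (c + d) in c+d≟0
  ...   | true = begin
    eval ts a n                ≡⟨ sym (+-identityˡ _) ⟩
    + 0 * X + eval ts a n      ≡⟨ cong (λ z → z * X + eval ts a n) (sym (isZero-sound (c + d) c+d≟0)) ⟩
    (c + d) * X + eval ts a n  ≡⟨ merge c d X (eval ts a n) ⟩
    c * X + (d * X + eval ts a n) ∎
    where
    X : ℤ
    X = monoShift i j ⟪ A ⟫ a n
    merge : ∀ c d x r → (c + d) * x + r ≡ c * x + (d * x + r)
    merge = solve-∀
  ...   | false = merge c d (monoShift i j ⟪ A ⟫ a n) (eval ts a n)
    where
    merge : ∀ c d x r → (c + d) * x + r ≡ c * x + (d * x + r)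
    merge = solve-∀

  normalise : List Term → List Term
  normalise [] = []
  normalise (t ∷ ts) = insert t (normalise ts)

  eval-normalise : ∀ ts a n → eval (normalise ts) a n ≡ eval ts a n
  eval-normalise [] a n = refl
  eval-normalise (term c i j A ∷ ts) a n =
    trans (eval-insert (term c i j A) (normalise ts) a n)
          (cong (λ z → c * monoShift i j ⟪ A ⟫ a n + z) (eval-normalise ts a n))

  withAtom : Atom → Poly → List Term
  withAtom A [] = []
  withAtom A ((c , i , j) ∷ p) = term c i j A ∷ withAtom A p

  eval-withAtom : ∀ p (F : Series) A → (∀ a n → F a n ≡ ⟪ A ⟫ a n) → ∀ a n → (p · F) a n ≡ eval (withAtom A p) a n
  eval-withAtom [] F A F≡A a n = refl
  eval-withAtom ((c , i , j) ∷ p) F A F≡A a n =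
    cong₂ (λ x y → c * x + y) (monoShift-cong i j F ⟪ A ⟫ F≡A a n) (eval-withAtom p F A F≡A a n)

module Certificate where

  open ≡-Reasoning
  open Counting using (⟦_⟧)
  open CountingFunctions using (K)
  open Relations using (B-peel; K-peel; K-lower-bound; K-free)
  open Shift using (Gshift≡B)
  open LinearCombinations
  open BooleanTests using (≤ᵇ-sound)
  open import Data.Nat as ℕ using (ℕ; zero; suc; _∸_; _≤ᵇ_; _≡ᵇ_)
  open import Data.Integer using (ℤ; +_; -_; _+_; _*_)
  open import Data.Integer.Properties using (*-zeroʳ; +-identityʳ; pos-+)
  open import Data.Integer.Tactic.RingSolver using (solve-∀)
  open import Data.Bool using (Bool; true; false; _∧_; if_then_else_)
  open import Data.List using (List; []; _∷_; _++_)
  open import Data.Product using (_×_; _,_)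

  -- names for the relations of the module Relations, each read as a linear
  -- combination whose value is 0
  data Relation : Set where
    peelB : ℕ → Relation
    lowerK peelK freeK : ℕ → ℕ → Relation

  relation : Relation → List Term
  relation (peelB m) =
    term (+ 1) 0 0 (atomB m) ∷ term (- + 1) 0 0 (atomB (suc m)) ∷ term (- + 1) 1 m (atomK 0 m) ∷ []
  relation (lowerK L u) =
    if L ≤ᵇ u then term (+ 1) 0 0 (atomK L u) ∷ term (- + 1) 0 0 (atomK 0 u) ∷ [] else []
  relation (peelK L u) =
    term (+ 1) 0 0 (atomK L u) ∷ term (- + 1) 0 0 (atomK (suc L) u)
      ∷ (if pairOk L u then term (- + 1) 1 L (atomK (u ℕ.+ 3) L) ∷ [] else [])
  relation (freeK L u) =
    if u ℕ.+ 3 ≤ᵇ L then term (+ 1) 0 0 (atomK L u) ∷ term (- + 1) 0 0 (atomB L) ∷ [] else []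

  difference-zero : ∀ (x y : ℕ) → x ≡ y → + 1 * + x + (- + 1 * + y + + 0) ≡ + 0
  difference-zero x y refl = cancel (+ x)
    where
    cancel : ∀ X → + 1 * X + (- + 1 * X + + 0) ≡ + 0
    cancel = solve-∀

  difference₃-zero : ∀ (x y : ℕ) (p : Bool) (k : ℕ) → x ≡ (if p then k else 0) ℕ.+ y →
    + 1 * + x + (- + 1 * + y + (- + 1 * (if p then + k else + 0) + + 0)) ≡ + 0
  difference₃-zero x y true k refl rewrite pos-+ k y = cancel (+ k) (+ y)
    where
    cancel : ∀ K Y → + 1 * (K + Y) + (- + 1 * Y + (- + 1 * K + + 0)) ≡ + 0
    cancel = solve-∀
  difference₃-zero x y false k refl = difference₃-zero y y true 0 refl

  relation-vanishes : ∀ r a n → eval (relation r) a n ≡ + 0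
  relation-vanishes (peelB m) zero n = difference₃-zero ⟦ 0 ≡ᵇ n ⟧ ⟦ 0 ≡ᵇ n ⟧ true 0 refl
  relation-vanishes (peelB m) (suc a) n = difference₃-zero _ _ (m ≤ᵇ n) (K 0 m a (n ∸ m)) (B-peel m a n)
  relation-vanishes (lowerK L u) a n with L ≤ᵇ u in L≤u
  ... | true = difference-zero _ _ (K-lower-bound L u a n (≤ᵇ-sound L u L≤u))
  ... | false = refl
  relation-vanishes (freeK L u) a n with u ℕ.+ 3 ≤ᵇ L in u+3≤L
  ... | true = difference-zero _ _ (K-free L u a n (≤ᵇ-sound (u ℕ.+ 3) L u+3≤L))
  ... | false = refl
  relation-vanishes (peelK L u) zero n with pairOk L u
  ... | true = difference₃-zero ⟦ 0 ≡ᵇ n ⟧ ⟦ 0 ≡ᵇ n ⟧ true 0 refl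
  ... | false = difference-zero ⟦ 0 ≡ᵇ n ⟧ ⟦ 0 ≡ᵇ n ⟧ refl
  relation-vanishes (peelK L u) (suc a) n with pairOk L u | K-peel L u a n
  ... | true | peel = difference₃-zero _ _ (L ≤ᵇ n) (K (u ℕ.+ 3) L a (n ∸ L)) peel
  ... | false | peel = difference-zero _ _ peel

  combination : List (ℤ × ℕ × ℕ × Relation) → List Term
  combination [] = []
  combination ((c , i , j , r) ∷ cs) = scale c i j (relation r) ++ combination cs

  combination-vanishes : ∀ cs a n → eval (combination cs) a n ≡ + 0
  combination-vanishes [] a n = refl
  combination-vanishes ((c , i , j , r) ∷ cs) a n = begin
    eval (scale c i j (relation r) ++ combination cs) a n
      ≡⟨ eval-++ (scale c i j (relation r)) (combination cs) a n ⟩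
    eval (scale c i j (relation r)) a n + eval (combination cs) a n
      ≡⟨ cong₂ _+_ (eval-scale c i j (relation r) a n) (combination-vanishes cs a n) ⟩
    c * monoShift i j (eval (relation r)) a n + + 0
      ≡⟨ cong (λ z → c * z + + 0) (monoShift-cong i j _ (λ _ _ → + 0) (relation-vanishes r) a n) ⟩
    c * monoShift i j (λ _ _ → + 0) a n + + 0
      ≡⟨ cong (λ z → c * z + + 0) (shift-of-zero (i ≤ᵇ a) (j ≤ᵇ n)) ⟩
    c * + 0 + + 0
      ≡⟨ cong (_+ + 0) (*-zeroʳ c) ⟩
    + 0 ∎
    where
    shift-of-zero : ∀ p q → (if p ∧ q then + 0 else + 0) ≡ + 0
    shift-of-zero p q with p ∧ q
    ... | true = refl
    ... | false = refl

  -- the left-hand side of the theorem, with G(x q^{3k}) written as B (2 + 3k)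
  lhs : List Term
  lhs = withAtom (atomB 2) p0 ++ withAtom (atomB 5) p3 ++ withAtom (atomB 8) p6 ++ withAtom (atomB 11) p9

  lhs-as-combination : ∀ a n →
    (p0 · Gshift 0 ⊕ p3 · Gshift 3 ⊕ p6 · Gshift 6 ⊕ p9 · Gshift 9) a n ≡ eval lhs a n
  lhs-as-combination a n = begin
    P₀ + P₃ + P₆ + P₉
      ≡⟨ cong₂ _+_ (cong₂ _+_ (cong₂ _+_ (part p0 0 a n) (part p3 1 a n)) (part p6 2 a n)) (part p9 3 a n) ⟩
    A₀ + A₃ + A₆ + A₉
      ≡⟨ reassociate A₀ A₃ A₆ A₉ ⟩
    A₀ + (A₃ + (A₆ + A₉))
      ≡⟨ sym (cong (λ z → A₀ + z) (trans (eval-++ L₃ (L₆ ++ L₉) a n) (cong (λ z → A₃ + z) (eval-++ L₆ L₉ a n)))) ⟩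
    A₀ + eval (L₃ ++ L₆ ++ L₉) a n
      ≡⟨ sym (eval-++ L₀ (L₃ ++ L₆ ++ L₉) a n) ⟩
    eval lhs a n ∎
    where
    part : ∀ p k → ∀ a n → (p · Gshift (3 ℕ.* k)) a n ≡ eval (withAtom (atomB (2 ℕ.+ 3 ℕ.* k)) p) a n
    part p k = eval-withAtom p (Gshift (3 ℕ.* k)) (atomB (2 ℕ.+ 3 ℕ.* k)) (Gshift≡B k)
    P₀ = (p0 · Gshift 0) a n
    P₃ = (p3 · Gshift 3) a n
    P₆ = (p6 · Gshift 6) a n
    P₉ = (p9 · Gshift 9) a n
    L₀ = withAtom (atomB 2) p0
    L₃ = withAtom (atomB 5) p3
    L₆ = withAtom (atomB 8) p6
    L₉ = withAtom (atomB 11) p9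
    A₀ = eval L₀ a n
    A₃ = eval L₃ a n
    A₆ = eval L₆ a n
    A₉ = eval L₉ a n
    reassociate : ∀ a b c d → a + b + c + d ≡ a + (b + (c + d))
    reassociate = solve-∀

  certificate : List (ℤ × ℕ × ℕ × Relation)
  certificate =
    (- + 1 , 0 , 0 , peelB 2) ∷
    (+ 1 , 1 , 2 , lowerK 2 2) ∷
    (- + 1 , 1 , 2 , peelK 2 2) ∷
    (- + 1 , 1 , 2 , peelK 3 2) ∷
    (- + 1 , 1 , 2 , peelK 4 2) ∷
    (- + 1 , 1 , 2 , freeK 5 2) ∷
    (- + 1 , 1 , 5 , peelB 2) ∷
    (+ 1 , 2 , 7 , lowerK 2 2) ∷
    (- + 1 , 2 , 7 , peelK 2 2) ∷
    (- + 1 , 2 , 7 , peelK 3 2) ∷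
    (- + 1 , 2 , 7 , peelK 4 2) ∷
    (- + 1 , 2 , 7 , freeK 5 2) ∷
    (- + 1 , 1 , 8 , peelB 2) ∷
    (+ 1 , 2 , 10 , lowerK 2 2) ∷
    (- + 1 , 2 , 10 , peelK 2 2) ∷
    (- + 1 , 2 , 10 , peelK 3 2) ∷
    (- + 1 , 2 , 10 , peelK 4 2) ∷
    (- + 1 , 2 , 10 , freeK 5 2) ∷
    (- + 1 , 0 , 0 , peelB 3) ∷
    (+ 1 , 1 , 3 , lowerK 3 3) ∷
    (- + 1 , 1 , 3 , peelK 3 3) ∷
    (- + 1 , 2 , 6 , freeK 6 3) ∷
    (- + 1 , 1 , 3 , peelK 4 3) ∷
    (- + 1 , 1 , 3 , peelK 5 3) ∷
    (- + 1 , 1 , 3 , freeK 6 3) ∷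
    (+ 1 , 1 , 3 , peelB 5) ∷
    (- + 1 , 2 , 8 , lowerK 5 5) ∷
    (+ 1 , 2 , 8 , peelK 5 5) ∷
    (- + 1 , 1 , 5 , peelB 3) ∷
    (+ 1 , 2 , 8 , lowerK 3 3) ∷
    (- + 1 , 2 , 8 , peelK 3 3) ∷
    (- + 1 , 3 , 11 , freeK 6 3) ∷
    (- + 1 , 2 , 8 , peelK 4 3) ∷
    (- + 1 , 2 , 8 , peelK 5 3) ∷
    (- + 1 , 2 , 8 , freeK 6 3) ∷
    (+ 1 , 2 , 8 , peelB 5) ∷
    (- + 1 , 3 , 13 , lowerK 5 5) ∷
    (+ 1 , 3 , 13 , peelK 5 5) ∷
    (- + 1 , 1 , 8 , peelB 3) ∷
    (+ 1 , 2 , 11 , lowerK 3 3) ∷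
    (- + 1 , 2 , 11 , peelK 3 3) ∷
    (- + 1 , 3 , 14 , freeK 6 3) ∷
    (- + 1 , 2 , 11 , peelK 4 3) ∷
    (- + 1 , 2 , 11 , peelK 5 3) ∷
    (- + 1 , 2 , 11 , freeK 6 3) ∷
    (+ 1 , 2 , 11 , peelB 5) ∷
    (- + 1 , 3 , 16 , lowerK 5 5) ∷
    (+ 1 , 3 , 16 , peelK 5 5) ∷
    (- + 1 , 2 , 6 , peelK 5 4) ∷
    (- + 1 , 2 , 6 , peelK 6 4) ∷
    (- + 1 , 2 , 6 , freeK 7 4) ∷
    (+ 1 , 2 , 6 , peelB 6) ∷
    (- + 1 , 3 , 12 , lowerK 6 6) ∷
    (+ 1 , 3 , 12 , peelK 6 6) ∷
    (+ 1 , 4 , 18 , freeK 9 6) ∷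
    (+ 1 , 3 , 11 , peelK 7 5) ∷
    (+ 1 , 3 , 11 , freeK 8 5) ∷
    (- + 1 , 3 , 11 , peelB 7) ∷
    (+ 1 , 4 , 18 , lowerK 7 7) ∷
    (- + 1 , 4 , 18 , peelK 7 7) ∷
    (- + 1 , 3 , 11 , peelK 5 4) ∷
    (- + 1 , 3 , 11 , peelK 6 4) ∷
    (- + 1 , 3 , 11 , freeK 7 4) ∷
    (- + 1 , 3 , 14 , peelK 5 4) ∷
    (- + 1 , 3 , 14 , peelK 6 4) ∷
    (- + 1 , 3 , 14 , freeK 7 4) ∷
    (+ 1 , 3 , 14 , peelB 6) ∷
    (- + 1 , 4 , 20 , lowerK 6 6) ∷
    (+ 1 , 4 , 20 , peelK 6 6) ∷
    (+ 1 , 5 , 26 , freeK 9 6) ∷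
    (+ 1 , 4 , 19 , peelK 7 5) ∷
    (+ 1 , 4 , 19 , freeK 8 5) ∷
    (- + 1 , 0 , 0 , peelB 4) ∷
    (+ 1 , 1 , 4 , lowerK 4 4) ∷
    (- + 1 , 1 , 4 , peelK 4 4) ∷
    (- + 1 , 1 , 4 , peelK 5 4) ∷
    (- + 1 , 1 , 4 , peelK 6 4) ∷
    (- + 1 , 1 , 4 , freeK 7 4) ∷
    (+ 1 , 1 , 4 , peelB 6) ∷
    (- + 1 , 2 , 10 , lowerK 6 6) ∷
    (+ 1 , 2 , 10 , peelK 6 6) ∷
    (+ 1 , 3 , 16 , freeK 9 6) ∷
    (- + 1 , 1 , 5 , peelB 4) ∷
    (+ 1 , 2 , 9 , lowerK 4 4) ∷
    (- + 1 , 2 , 9 , peelK 4 4) ∷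
    (- + 1 , 2 , 9 , peelK 5 4) ∷
    (- + 1 , 2 , 9 , peelK 6 4) ∷
    (- + 1 , 2 , 9 , freeK 7 4) ∷
    (+ 1 , 2 , 9 , peelB 6) ∷
    (- + 1 , 3 , 15 , lowerK 6 6) ∷
    (+ 1 , 3 , 15 , peelK 6 6) ∷
    (+ 1 , 4 , 21 , freeK 9 6) ∷
    (- + 1 , 1 , 8 , peelB 4) ∷
    (+ 1 , 2 , 12 , lowerK 4 4) ∷
    (- + 1 , 2 , 12 , peelK 4 4) ∷
    (- + 1 , 2 , 12 , peelK 5 4) ∷
    (- + 1 , 2 , 12 , peelK 6 4) ∷
    (- + 1 , 2 , 12 , freeK 7 4) ∷
    (+ 1 , 2 , 12 , peelB 6) ∷
    (- + 1 , 3 , 18 , lowerK 6 6) ∷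
    (+ 1 , 3 , 18 , peelK 6 6) ∷
    (+ 1 , 4 , 24 , freeK 9 6) ∷
    (+ 1 , 3 , 17 , peelB 7) ∷
    (- + 1 , 4 , 24 , lowerK 7 7) ∷
    (+ 1 , 4 , 24 , peelK 7 7) ∷
    (+ 1 , 1 , 4 , peelB 5) ∷
    (- + 1 , 2 , 9 , lowerK 5 5) ∷
    (+ 1 , 2 , 9 , peelK 5 5) ∷
    (+ 1 , 2 , 9 , peelK 6 5) ∷
    (+ 2 , 2 , 6 , peelB 5) ∷
    (- + 2 , 3 , 11 , lowerK 5 5) ∷
    (+ 2 , 3 , 11 , peelK 5 5) ∷
    (+ 2 , 3 , 11 , peelK 6 5) ∷
    (+ 1 , 2 , 9 , peelB 5) ∷
    (- + 1 , 3 , 14 , lowerK 5 5) ∷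
    (+ 1 , 3 , 14 , peelK 5 5) ∷
    (+ 1 , 3 , 14 , peelK 6 5) ∷
    (+ 1 , 2 , 12 , peelB 5) ∷
    (- + 1 , 3 , 17 , lowerK 5 5) ∷
    (+ 1 , 3 , 17 , peelK 5 5) ∷
    (+ 1 , 3 , 17 , peelK 6 5) ∷
    (+ 1 , 3 , 11 , peelB 5) ∷
    (- + 1 , 4 , 16 , lowerK 5 5) ∷
    (+ 1 , 4 , 16 , peelK 5 5) ∷
    (+ 1 , 4 , 16 , peelK 6 5) ∷
    (+ 2 , 3 , 14 , peelB 5) ∷
    (- + 2 , 4 , 19 , lowerK 5 5) ∷
    (+ 2 , 4 , 19 , peelK 5 5) ∷
    (+ 2 , 4 , 19 , peelK 6 5) ∷
    (+ 1 , 3 , 17 , peelB 5) ∷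
    (- + 1 , 4 , 22 , lowerK 5 5) ∷
    (+ 1 , 4 , 22 , peelK 5 5) ∷
    (+ 1 , 4 , 22 , peelK 6 5) ∷
    (+ 1 , 4 , 22 , peelK 7 5) ∷
    (+ 1 , 4 , 22 , freeK 8 5) ∷
    (- + 1 , 4 , 17 , peelK 7 6) ∷
    (- + 1 , 4 , 17 , peelK 8 6) ∷
    (- + 1 , 4 , 17 , freeK 9 6) ∷
    (+ 1 , 4 , 17 , peelB 8) ∷
    (- + 1 , 5 , 25 , lowerK 8 8) ∷
    (+ 1 , 5 , 25 , peelK 8 8) ∷
    (+ 1 , 3 , 17 , peelB 6) ∷
    (- + 1 , 4 , 23 , lowerK 6 6) ∷
    (+ 1 , 4 , 23 , peelK 6 6) ∷
    (+ 1 , 5 , 29 , freeK 9 6) ∷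
    (+ 1 , 4 , 23 , peelK 7 6) ∷
    (+ 1 , 4 , 23 , peelK 8 6) ∷
    (+ 1 , 4 , 23 , freeK 9 6) ∷
    (- + 1 , 4 , 23 , peelB 8) ∷
    (+ 1 , 5 , 31 , lowerK 8 8) ∷
    (- + 1 , 5 , 31 , peelK 8 8) ∷
    (+ 1 , 5 , 26 , peelK 8 7) ∷
    (+ 1 , 5 , 26 , peelK 9 7) ∷
    (+ 1 , 5 , 26 , freeK 10 7) ∷
    (+ 1 , 5 , 29 , peelK 8 7) ∷
    (+ 1 , 5 , 29 , peelK 9 7) ∷
    (+ 1 , 5 , 29 , freeK 10 7) ∷
    (+ 1 , 4 , 24 , peelK 8 7) ∷
    (+ 1 , 4 , 24 , peelK 9 7) ∷
    (+ 1 , 4 , 24 , freeK 10 7) ∷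
    (- + 1 , 3 , 16 , peelB 8) ∷
    (+ 1 , 4 , 24 , lowerK 8 8) ∷
    (- + 1 , 4 , 24 , peelK 8 8) ∷
    (- + 1 , 4 , 24 , peelK 9 8) ∷
    (- + 1 , 4 , 24 , peelK 10 8) ∷
    (- + 1 , 4 , 24 , freeK 11 8) ∷
    (+ 1 , 4 , 24 , peelB 10) ∷
    (- + 1 , 5 , 34 , lowerK 10 10) ∷
    (+ 1 , 5 , 34 , peelK 10 10) ∷
    (- + 1 , 4 , 18 , peelB 8) ∷
    (+ 1 , 5 , 26 , lowerK 8 8) ∷
    (- + 1 , 5 , 26 , peelK 8 8) ∷
    (- + 1 , 5 , 26 , peelK 9 8) ∷
    (- + 1 , 5 , 26 , peelK 10 8) ∷
    (- + 1 , 5 , 26 , freeK 11 8) ∷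
    (+ 1 , 5 , 26 , peelB 10) ∷
    (- + 1 , 6 , 36 , lowerK 10 10) ∷
    (+ 1 , 6 , 36 , peelK 10 10) ∷
    (- + 1 , 4 , 21 , peelB 8) ∷
    (+ 1 , 5 , 29 , lowerK 8 8) ∷
    (- + 1 , 5 , 29 , peelK 8 8) ∷
    (- + 1 , 5 , 29 , peelK 9 8) ∷
    (- + 1 , 5 , 29 , peelK 10 8) ∷
    (- + 1 , 5 , 29 , freeK 11 8) ∷
    (+ 1 , 5 , 29 , peelB 10) ∷
    (- + 1 , 6 , 39 , lowerK 10 10) ∷
    (+ 1 , 6 , 39 , peelK 10 10) ∷
    (- + 1 , 4 , 24 , peelB 8) ∷
    (+ 1 , 5 , 32 , lowerK 8 8) ∷
    (- + 1 , 5 , 32 , peelK 8 8) ∷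
    (- + 1 , 5 , 32 , peelK 9 8) ∷
    (- + 1 , 5 , 26 , peelB 8) ∷
    (+ 1 , 6 , 34 , lowerK 8 8) ∷
    (- + 1 , 6 , 34 , peelK 8 8) ∷
    (- + 1 , 6 , 34 , peelK 9 8) ∷
    (- + 1 , 5 , 29 , peelB 8) ∷
    (+ 1 , 6 , 37 , lowerK 8 8) ∷
    (- + 1 , 6 , 37 , peelK 8 8) ∷
    (- + 1 , 6 , 37 , peelK 9 8) ∷
    (+ 1 , 6 , 35 , peelK 10 9) ∷
    (+ 1 , 6 , 35 , peelK 11 9) ∷
    (+ 1 , 6 , 35 , freeK 12 9) ∷
    (- + 1 , 6 , 35 , peelB 11) ∷
    (+ 1 , 7 , 46 , lowerK 11 11) ∷
    (- + 1 , 7 , 46 , peelK 11 11) ∷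
    (+ 1 , 5 , 33 , peelK 10 9) ∷
    (+ 1 , 5 , 33 , peelK 11 9) ∷
    (+ 1 , 5 , 33 , freeK 12 9) ∷
    (- + 1 , 5 , 33 , peelB 11) ∷
    (+ 1 , 6 , 44 , lowerK 11 11) ∷
    (- + 1 , 6 , 44 , peelK 11 11) ∷
    (+ 1 , 6 , 38 , peelK 10 9) ∷
    (+ 1 , 6 , 38 , peelK 11 9) ∷
    (+ 1 , 6 , 38 , freeK 12 9) ∷
    (- + 1 , 6 , 38 , peelB 11) ∷
    (+ 1 , 7 , 49 , lowerK 11 11) ∷
    (- + 1 , 7 , 49 , peelK 11 11) ∷
    []

  exact-cancellation : normalise (lhs ++ combination certificate) ≡ []
  exact-cancellation = refl

  lhs-vanishes : ∀ a n → eval lhs a n ≡ + 0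
  lhs-vanishes a n = begin
    eval lhs a n                                      ≡⟨ sym (+-identityʳ _) ⟩
    eval lhs a n + + 0                                ≡⟨ cong (λ z → eval lhs a n + z) (sym (combination-vanishes certificate a n)) ⟩
    eval lhs a n + eval (combination certificate) a n ≡⟨ sym (eval-++ lhs (combination certificate) a n) ⟩
    eval (lhs ++ combination certificate) a n         ≡⟨ sym (eval-normalise (lhs ++ combination certificate) a n) ⟩
    eval (normalise (lhs ++ combination certificate)) a n ≡⟨ cong (λ ts → eval ts a n) exact-cancellation ⟩
    + 0 ∎

open import Data.Nat using (ℕ)
open import Data.Integer using (+_)

mainTheorem7 : (a n : ℕ) →
    (p0 · Gshift 0 ⊕ p3 · Gshift 3 ⊕ p6 · Gshift 6 ⊕ p9 · Gshift 9) a n ≡ + 0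
mainTheorem7 a n = trans (lhs-as-combination a n) (lhs-vanishes a n)
  where open Certificate
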